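{- Let $q\geq 2$ be a prime power and $n$ a positive integer with $n\not\equiv 0\pmod 3$. Let $\omega\in\mathbb{F}_{q^{2n}}\setminus\mathbb{F}_{q^n}$, let $a\in\mathbb{F}_{q^{3n}}^*$ and let $i$ be an integer with $1\leq i\leq 3n-1$ such that (i) $\gcd(i,2n)=1$ and $\gcd(i,3n)=3$, and (ii) $N_{q^{3n}/q^3}(a)\notin\mathbb{F}_q$. Then $$L_U=\{\langle ax^{q^i}+x\omega\rangle_{\mathbb{F}_{q^{2n}}} : x\in\mathbb{F}_{q^{3n}}^*\},\qquad U=\{ax^{q^i}+x\omega: x\in\mathbb{F}_{q^{3n}}\},$$ is a scattered $\mathbb{F}_q$-linear set of rank $3n$ of the projective plane $PG(2,q^{2n})=PG(\mathbb{F}_{q^{6n}},\mathbb{F}_{q^{2n}})$.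
   Context: $N_{q^{3n}/q^3}$ denotes the norm map from $\mathbb{F}_{q^{3n}}$ to $\mathbb{F}_{q^3}$. $\mathbb{F}_{q^{6n}}$ is regarded as a $3$-dimensional vector space over $\mathbb{F}_{q^{2n}}$. For an $\mathbb{F}_q$-subspace $U$ of $\mathbb{F}_{q^{6n}}$ of $\mathbb{F}_q$-dimension $k$, $L_U=\{\langle u\rangle_{\mathbb{F}_{q^{2n}}}: u\in U\setminus\{0\}\}$ is an $\mathbb{F}_q$-linear set of rank $k$; it is scattered if every point $\langle v\rangle$ of $L_U$ satisfies $\dim_{\mathbb{F}_q}(U\cap\langle v\rangle_{\mathbb{F}_{q^{2n}}})=1$. -}

module Defs where

open import Level using (0ℓ)
open import Data.Nat as ℕ using (ℕ; zero; suc; _≥_)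
open import Data.Nat.Primality using (Prime)
open import Data.Fin using (Fin)
open import Data.Product using (Σ; _×_; _,_)
open import Relation.Binary.PropositionalEquality using (_≡_; _≢_)
open import Algebra.Structures using (IsCommutativeRing)
open import Function.Bundles using (_↔_)

IsPrimePower : ℕ → Set
IsPrimePower q = Σ ℕ λ p → Σ ℕ λ k → Prime p × k ≥ 1 × q ≡ p ℕ.^ k

record FiniteField : Set₁ where
  infixl 7 _*_
  infixl 6 _+_
  field
    Carrier : Set
    _+_ _*_ : Carrier → Carrier → Carrier
    -_ : Carrier → Carrier
    0# 1# : Carrier
    isCommutativeRing : IsCommutativeRing {A = Carrier} _≡_ _+_ _*_ -_ 0# 1#
    0≢1 : 0# ≢ 1#
    inverse : (x : Carrier) → x ≢ 0# → Σ Carrier λ y → x * y ≡ 1#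
    size : ℕ
    enumeration : Carrier ↔ Fin size

  _^_ : Carrier → ℕ → Carrier
  x ^ zero = 1#
  x ^ suc m = x * (x ^ m)

module FieldNotions (F : FiniteField) (q : ℕ) where
  open FiniteField F

  -- membership in the subfield F_{q^m} = { x : x^(q^m) = x }
  InSub : ℕ → Carrier → Set
  InSub m x = x ^ (q ℕ.^ m) ≡ x

  prod : ℕ → (ℕ → Carrier) → Carrier
  prod zero f = 1#
  prod (suc k) f = prod k f * f k

  norm3 : ℕ → Carrier → Carrier
  norm3 n a = prod n (λ j → a ^ (q ℕ.^ (3 ℕ.* j)))

  fmap : Carrier → ℕ → Carrier → Carrier → Carrier
  fmap a i ω x = a * (x ^ (q ℕ.^ i)) + x * ω

  -- U = { f x : x ∈ F_{q^{3n}} } has F_q-rank 3n: f is injective on F_{q^{3n}}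
  HasRank3n : ℕ → (Carrier → Carrier) → Set
  HasRank3n n f = ∀ x y → InSub (3 ℕ.* n) x → InSub (3 ℕ.* n) y → f x ≡ f y → x ≡ y

  -- L_U scattered: for every nonzero v = f x ∈ U, U ∩ ⟨v⟩_{F_{q^{2n}}} = F_q v,
  -- i.e. dim_{F_q}(U ∩ ⟨v⟩_{F_{q^{2n}}}) = 1
  Scattered : ℕ → (Carrier → Carrier) → Set
  Scattered n f = ∀ x → InSub (3 ℕ.* n) x → f x ≢ 0# →
    ∀ y → InSub (3 ℕ.* n) y → ∀ λ′ → InSub (2 ℕ.* n) λ′ → f y ≡ λ′ * f x → InSub 1 λ′

{-# OPTIONS --safe #-}
-- Write K = F_{q^{3n}}, L = F_{q^{2n}}, z̄ = z^{q^{3n}} and Φ z = a z^{q^i}, so that f z = Φ z + z ω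
-- and, for z ∈ K, f̄ z = Φ z + z ω̄.  As δ = ω - ω̄ ≠ 0, the pair (f z, f̄ z) determines z and Φ z,
-- which gives injectivity.  Let f y = λ f x with λ ∈ L.  If λ̄ = λ then y = λ x, hence λ^{q^i} = λ
-- and λ ∈ F_{q^{gcd(i,2n)}} = F_q.  Otherwise y and Φ y both lie in the L-span of x and Φ x, y with
-- a nonzero Φ x-coordinate, which forces Φ² x into that span.  The span is then Φ-stable, so it
-- contains Φⁿ x = N x and Φ²ⁿ x = N² x, where N = ∏_{j<n} a^{q^{ij}} is N_{q^{3n}/q^3}(a) because
-- i = 3t with t prime to n.  So N ∈ F_{q^3} is a root of a nonzero polynomial of degree ≤ 2 over L,
-- whence N ∈ F_{q^{4n}} ∩ F_{q^3} = F_q, a contradiction.  Throughout, F_{q^m} = {z : z^{q^m} = z}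
-- is a subfield because z ↦ z^p is additive, p being the prime with |F| = p^{6kn}.
module Submission where

open import Defs

open import Algebra.Bundles using (CommutativeRing)
import Algebra.Properties.CommutativeMonoid.Sum as Sum
import Algebra.Properties.CommutativeSemigroup as CommutativeSemigroupProperties
import Algebra.Properties.CommutativeSemiring.Binomial as Binomial
import Algebra.Properties.Ring as RingProperties
import Algebra.Properties.Semiring.Exp as Exp
import Algebra.Properties.Semiring.Mult as Mult
import Algebra.Solver.Ring
open import Algebra.Solver.Ring.AlmostCommutativeRing using (_-Raw-AlmostCommutative⟶_; fromCommutativeRing)
open import Data.Fin as Fin using (Fin; toℕ; fromℕ; fromℕ<; inject₁)
import Data.Fin.Properties as Fin
open import Data.Fin.Permutation using (Permutation; permutation)
open import Data.Integer as ℤ using (ℤ; -[1+_])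
import Data.Integer.Properties as ℤ
open import Data.Maybe using (Maybe; just; nothing)
open import Data.Nat as ℕ using (ℕ; zero; suc)
import Data.Nat.Properties as ℕ
open import Data.Nat.Combinatorics using (_C_; nCn≡1)
open import Data.Nat.Coprimality using (Coprime; gcd≡1⇒coprime)
open import Data.Nat.Divisibility using (_∣_; _∤_; _∣?_; divides)
open import Data.Nat.DivMod using (_%_; _/_; m≡m%n+[m/n]*n)
open import Data.Nat.GCD using (gcd; gcd-GCD; module Bézout; gcd[m,n]∣m)
open import Data.Nat.GeneralisedArithmetic using (fold; fold-+)
open import Data.Nat.Primality using (Prime; prime⇒nonZero; prime?)
open import Data.Nat.Tactic.RingSolver using (solve-∀)
open import Data.Product using (Σ; ∃-syntax; _×_; _,_; proj₁; proj₂)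
open import Data.Sign as Sign using (Sign)
open import Data.Sum using (_⊎_; inj₁; inj₂; [_,_]′)
open import Function.Base using (_∘_; id)
open import Function.Bundles using (Inverse; Injection)
open import Function.Properties.Inverse using (↔⇒↣)
open import Level using (0ℓ)
open import Relation.Binary.PropositionalEquality
open import Relation.Nullary using (¬_; Dec; yes; no; map′; contradiction)
open import Relation.Nullary.Decidable using (from-yes; from-no)

module _ where
  open import Data.Nat
  open import Data.Nat.Properties
  open import Data.Nat.Combinatorics using (_C_; nC1≡n; k>n⇒nCk≡0; nCk+nC[k+1]≡[n+1]C[k+1])
  open import Data.Nat.Coprimality using (Coprime; coprime-Bézout; coprime-divisor; prime⇒coprime)
  open import Data.Nat.DivMod
  open import Data.Nat.Divisibility using (_∣_; _∤_; divides; ∣-trans)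
  open import Data.Nat.GCD using (gcd; module Bézout; gcd[m,n]∣m; gcd[m,n]∣n; c*gcd[m,n]≡gcd[cm,cn])
  open import Data.Nat.Primality using (Prime; euclidsLemma; prime⇒irreducible)
  open import Data.Nat.Tactic.RingSolver using (solve-∀; solve)
  open import Data.List.Base using (_∷_; [])
  open ≡-Reasoning

  [1+k]*[1+n]C[1+k]≡[1+n]*nCk : ∀ n k → suc k * (suc n C suc k) ≡ suc n * (n C k)
  [1+k]*[1+n]C[1+k]≡[1+n]*nCk zero    zero    = refl
  [1+k]*[1+n]C[1+k]≡[1+n]*nCk zero    (suc k) = begin
    (2 + k) * (1 C (2 + k))  ≡⟨ cong ((2 + k) *_) (k>n⇒nCk≡0 {1} {2 + k} (s≤s (s≤s z≤n))) ⟩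
    (2 + k) * 0              ≡⟨ *-zeroʳ (2 + k) ⟩
    0                        ≡⟨ k>n⇒nCk≡0 {0} {suc k} (s≤s z≤n) ⟨
    1 * (0 C suc k)          ∎
  [1+k]*[1+n]C[1+k]≡[1+n]*nCk (suc n) zero    =
    trans (*-identityˡ _) (trans (nC1≡n (2 + n)) (sym (*-identityʳ _)))
  [1+k]*[1+n]C[1+k]≡[1+n]*nCk (suc n) (suc k) = begin
    (2 + k) * ((2 + n) C (2 + k))           ≡⟨ cong ((2 + k) *_) (nCk+nC[k+1]≡[n+1]C[k+1] (suc n) (suc k)) ⟨
    (2 + k) * (A + B)                       ≡⟨ regroup k A B ⟩
    A + ((1 + k) * A + (2 + k) * B)         ≡⟨ cong₂ (λ x y → A + (x + y)) ([1+k]*[1+n]C[1+k]≡[1+n]*nCk n k)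
                                                 ([1+k]*[1+n]C[1+k]≡[1+n]*nCk n (suc k)) ⟩
    A + ((1 + n) * (n C k) + (1 + n) * (n C suc k)) ≡⟨ cong (A +_) (*-distribˡ-+ (1 + n) (n C k) (n C suc k)) ⟨
    A + (1 + n) * (n C k + n C suc k)       ≡⟨ cong (λ x → A + (1 + n) * x) (nCk+nC[k+1]≡[n+1]C[k+1] n k) ⟩
    (2 + n) * A                             ∎
    where
    A = suc n C suc k
    B = suc n C suc (suc k)
    regroup : ∀ k A B → (2 + k) * (A + B) ≡ A + ((1 + k) * A + (2 + k) * B)
    regroup = solve-∀

  prime∣pC[1+k] : ∀ {p} k → Prime p → suc k < p → p ∣ p C suc k
  prime∣pC[1+k] {suc n} k p-prime k<p = coprime-divisor (prime⇒coprime p-prime k<p)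
    (divides (n C k) (trans ([1+k]*[1+n]C[1+k]≡[1+n]*nCk n k) (*-comm (suc n) (n C k))))

  module _ {N : ℕ} .{{_ : NonZero N}} where

    m*[n%N]%N≡m*n%N : ∀ m n → (m * (n % N)) % N ≡ (m * n) % N
    m*[n%N]%N≡m*n%N m n = begin
      (m * (n % N)) % N              ≡⟨ %-distribˡ-* m (n % N) N ⟩
      ((m % N) * (n % N % N)) % N    ≡⟨ cong (λ x → ((m % N) * x) % N) (m%n%n≡m%n n N) ⟩
      ((m % N) * (n % N)) % N        ≡⟨ %-distribˡ-* m n N ⟨
      (m * n) % N                    ∎

    -- In the second Bézout case x t ≡ -1 (mod N), so u = x (x t) gives t u = (x t)² ≡ 1.
    coprime⇒*-invertible-% : ∀ {t} → Coprime t N → ∃[ u ] (t * u) % N ≡ 1 % N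
    coprime⇒*-invertible-% {t} t⊥N with coprime-Bézout t⊥N
    ... | Bézout.+- x y eq = x , (begin
      (t * x) % N      ≡⟨ cong (_% N) (trans eq (*-comm x t)) ⟨
      (1 + y * N) % N  ≡⟨ [m+kn]%n≡m%n 1 y N ⟩
      1 % N            ∎)
    ... | Bézout.-+ x y eq = x * (x * t) , (begin
      (t * (x * (x * t))) % N                ≡⟨ cong (_% N) (square x t) ⟩
      (x * t) * (x * t) % N                  ≡⟨ [m+kn]%n≡m%n ((x * t) * (x * t)) (2 * y) N ⟨
      ((x * t) * (x * t) + 2 * y * N) % N    ≡⟨ cong (_% N) (expand (x * t) y N eq) ⟩
      (1 + (y * y * N) * N) % N              ≡⟨ [m+kn]%n≡m%n 1 (y * y * N) N ⟩
      1 % N                                  ∎)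
      where
      square : ∀ x t → t * (x * (x * t)) ≡ (x * t) * (x * t)
      square = solve-∀
      expand : ∀ s y N → 1 + s ≡ y * N → s * s + 2 * y * N ≡ 1 + (y * y * N) * N
      expand s y N 1+s≡yN = begin
        s * s + 2 * y * N            ≡⟨ cong (s * s +_) (*-assoc 2 y N) ⟩
        s * s + 2 * (y * N)          ≡⟨ cong (λ z → s * s + 2 * z) 1+s≡yN ⟨
        s * s + 2 * (1 + s)          ≡⟨ solve (s ∷ []) ⟩
        1 + (1 + s) * (1 + s)        ≡⟨ cong (λ z → 1 + z * z) 1+s≡yN ⟩
        1 + (y * N) * (y * N)        ≡⟨ solve (y ∷ N ∷ []) ⟩
        1 + (y * y * N) * N          ∎

    _*%_ : ℕ → Fin N → Fin N
    t *% j = fromℕ< (m%n<n (t * toℕ j) N)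

    toℕ-*% : ∀ t j → toℕ (t *% j) ≡ (t * toℕ j) % N
    toℕ-*% t j = Fin.toℕ-fromℕ< (m%n<n (t * toℕ j) N)

    *%-inverse : ∀ {s t} → (s * t) % N ≡ 1 % N → ∀ j → s *% (t *% j) ≡ j
    *%-inverse {s} {t} st≡1 j = Fin.toℕ-injective (begin
      toℕ (s *% (t *% j))              ≡⟨ toℕ-*% s (t *% j) ⟩
      (s * toℕ (t *% j)) % N           ≡⟨ cong (λ x → (s * x) % N) (toℕ-*% t j) ⟩
      (s * ((t * toℕ j) % N)) % N      ≡⟨ m*[n%N]%N≡m*n%N s (t * toℕ j) ⟩
      (s * (t * toℕ j)) % N            ≡⟨ cong (_% N) (trans (*-comm (toℕ j) (s * t)) (*-assoc s t (toℕ j))) ⟨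
      (toℕ j * (s * t)) % N            ≡⟨ m*[n%N]%N≡m*n%N (toℕ j) (s * t) ⟨
      (toℕ j * ((s * t) % N)) % N      ≡⟨ cong (λ x → (toℕ j * x) % N) st≡1 ⟩
      (toℕ j * (1 % N)) % N            ≡⟨ m*[n%N]%N≡m*n%N (toℕ j) 1 ⟩
      (toℕ j * 1) % N                  ≡⟨ cong (_% N) (*-identityʳ (toℕ j)) ⟩
      toℕ j % N                        ≡⟨ m<n⇒m%n≡m (Fin.toℕ<n j) ⟩
      toℕ j                            ∎)

    *%-permutation : ∀ {t} → Coprime t N → Permutation N N
    *%-permutation {t} t⊥N = permutation (t *%_) (u *%_) (*%-inverse {t} {u} tu≡1) (*%-inverse {u} {t} ut≡1)
      where
      u : ℕ
      u = proj₁ (coprime⇒*-invertible-% t⊥N)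
      tu≡1 : (t * u) % N ≡ 1 % N
      tu≡1 = proj₂ (coprime⇒*-invertible-% t⊥N)
      ut≡1 : (u * t) % N ≡ 1 % N
      ut≡1 = trans (cong (_% N) (*-comm u t)) tu≡1

  prime∤⇒gcd≡1 : ∀ {p n} → Prime p → p ∤ n → gcd p n ≡ 1
  prime∤⇒gcd≡1 {p} {n} p-prime p∤n with prime⇒irreducible p-prime (gcd[m,n]∣m p n)
  ... | inj₁ gcd≡1 = gcd≡1
  ... | inj₂ gcd≡p = contradiction (subst (_∣ n) gcd≡p (gcd[m,n]∣n p n)) p∤n

  prime∤-* : ∀ {p m n} → Prime p → p ∤ m → p ∤ n → p ∤ m * n
  prime∤-* p-prime p∤m p∤n p∣mn = [ p∤m , p∤n ]′ (euclidsLemma _ _ p-prime p∣mn)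

  gcd[3n,2n]≡n : ∀ n → gcd (3 * n) (2 * n) ≡ n
  gcd[3n,2n]≡n n = begin
    gcd (3 * n) (2 * n)  ≡⟨ cong₂ gcd (*-comm 3 n) (*-comm 2 n) ⟩
    gcd (n * 3) (n * 2)  ≡⟨ c*gcd[m,n]≡gcd[cm,cn] n 3 2 ⟨
    n * 1                ≡⟨ *-identityʳ n ⟩
    n                    ∎

  coprime-∣ : ∀ {m m′ n n′} → m′ ∣ m → n′ ∣ n → Coprime m n → Coprime m′ n′
  coprime-∣ m′∣m n′∣n m⊥n (d∣m′ , d∣n′) = m⊥n (∣-trans d∣m′ m′∣m , ∣-trans d∣n′ n′∣n)

module FiniteFieldTheory (F : FiniteField) where
  open FiniteField F
  open ≡-Reasoning

  commutativeRing : CommutativeRing 0ℓ 0ℓ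
  commutativeRing = record { isCommutativeRing = isCommutativeRing }

  open CommutativeRing commutativeRing
    using ( _-_; +-comm; +-identityˡ; +-identityʳ; -‿inverseʳ
          ; *-comm; *-assoc; *-identityˡ; *-identityʳ; zeroˡ; zeroʳ
          ; ring; semiring; commutativeSemiring; +-commutativeMonoid; *-commutativeMonoid
          ; +-commutativeSemigroup; *-commutativeSemigroup)
  open RingProperties ring
    using (-0#≈0#; -‿involutive; -‿+-comm; -‿distribˡ-*; -1*x≈-x; +-cancelˡ; +-inverseʳ-unique
          ; +-cancelʳ; x+x≈x⇒x≈0; x∙y⁻¹≈ε⇒x≈y; x[y-z]≈xy-xz)
  open Exp semiring using () renaming (_^_ to _^ₛ_)
  open Mult semiring using (×-homo-+; ×1-homo-*; ×-assoc-*) renaming (_×_ to _·_)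
  open CommutativeSemigroupProperties +-commutativeSemigroup using () renaming (interchange to +-interchange)
  open CommutativeSemigroupProperties *-commutativeSemigroup using (xy∙z≈xz∙y) renaming (interchange to *-interchange)

  -- The ring solver needs coefficients with decidable equality: it works over ℤ through fromℤ.
  fromSign : Sign → Carrier
  fromSign Sign.+ = 1#
  fromSign Sign.- = - 1#

  fromℤ : ℤ → Carrier
  fromℤ (ℤ.+ n)    = n · 1#
  fromℤ -[1+ n ] = - (suc n · 1#)

  fromSign-* : ∀ s t → fromSign (s Sign.* t) ≡ fromSign s * fromSign t
  fromSign-* Sign.+ t       = sym (*-identityˡ _)
  fromSign-* Sign.- Sign.+  = sym (*-identityʳ _)
  fromSign-* Sign.- Sign.-  = sym (trans (-1*x≈-x (- 1#)) (-‿involutive 1#))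

  fromℤ-◃ : ∀ s n → fromℤ (s ℤ.◃ n) ≡ fromSign s * n · 1#
  fromℤ-◃ s      zero    = sym (zeroʳ _)
  fromℤ-◃ Sign.+ (suc n) = sym (*-identityˡ _)
  fromℤ-◃ Sign.- (suc n) = trans (cong -_ (sym (*-identityˡ _))) (-‿distribˡ-* 1# _)

  fromℤ-⊖ : ∀ m n → fromℤ (m ℤ.⊖ n) ≡ m · 1# - n · 1#
  fromℤ-⊖ m       zero    = sym (trans (cong ((m · 1#) +_) -0#≈0#) (+-identityʳ _))
  fromℤ-⊖ zero    (suc n) = sym (+-identityˡ _)
  fromℤ-⊖ (suc m) (suc n) = begin
    fromℤ (suc m ℤ.⊖ suc n)            ≡⟨ cong fromℤ (ℤ.[1+m]⊖[1+n]≡m⊖n m n) ⟩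
    fromℤ (m ℤ.⊖ n)                    ≡⟨ fromℤ-⊖ m n ⟩
    M - N                              ≡⟨ +-identityˡ (M - N) ⟨
    0# + (M - N)                       ≡⟨ cong (_+ (M - N)) (-‿inverseʳ 1#) ⟨
    (1# - 1#) + (M - N)                ≡⟨ +-interchange 1# (- 1#) M (- N) ⟩
    (1# + M) + (- 1# + - N)            ≡⟨ cong ((1# + M) +_) (-‿+-comm 1# N) ⟩
    (1# + M) - (1# + N)                ∎
    where
    M = m · 1#
    N = n · 1#

  fromℤ-+ : ∀ i j → fromℤ (i ℤ.+ j) ≡ fromℤ i + fromℤ j
  fromℤ-+ (ℤ.+ m)    (ℤ.+ n)    = ×-homo-+ 1# m n
  fromℤ-+ (ℤ.+ m)    -[1+ n ] = fromℤ-⊖ m (suc n)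
  fromℤ-+ -[1+ m ] (ℤ.+ n)    = trans (fromℤ-⊖ n (suc m)) (+-comm _ _)
  fromℤ-+ -[1+ m ] -[1+ n ] = begin
    - ((2 ℕ.+ (m ℕ.+ n)) · 1#)         ≡⟨ cong (λ k → - (suc k · 1#)) (ℕ.+-suc m n) ⟨
    - ((suc m ℕ.+ suc n) · 1#)         ≡⟨ cong -_ (×-homo-+ 1# (suc m) (suc n)) ⟩
    - (suc m · 1# + suc n · 1#)        ≡⟨ -‿+-comm _ _ ⟨
    fromℤ -[1+ m ] + fromℤ -[1+ n ]    ∎

  fromℤ-‿ : ∀ i → fromℤ (ℤ.- i) ≡ - fromℤ i
  fromℤ-‿ -[1+ n ]  = sym (-‿involutive _)
  fromℤ-‿ (ℤ.+ zero)  = sym -0#≈0#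
  fromℤ-‿ (ℤ.+ suc n) = refl

  fromℤ-* : ∀ i j → fromℤ (i ℤ.* j) ≡ fromℤ i * fromℤ j
  fromℤ-* i j = begin
    fromℤ (i ℤ.* j)
      ≡⟨ fromℤ-◃ (ℤ.sign i Sign.* ℤ.sign j) (ℤ.∣ i ∣ ℕ.* ℤ.∣ j ∣) ⟩
    fromSign (ℤ.sign i Sign.* ℤ.sign j) * (ℤ.∣ i ∣ ℕ.* ℤ.∣ j ∣) · 1#
      ≡⟨ cong₂ _*_ (fromSign-* (ℤ.sign i) (ℤ.sign j)) (×1-homo-* ℤ.∣ i ∣ ℤ.∣ j ∣) ⟩
    (fromSign (ℤ.sign i) * fromSign (ℤ.sign j)) * (ℤ.∣ i ∣ · 1# * ℤ.∣ j ∣ · 1#)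
      ≡⟨ *-interchange _ _ _ _ ⟩
    (fromSign (ℤ.sign i) * ℤ.∣ i ∣ · 1#) * (fromSign (ℤ.sign j) * ℤ.∣ j ∣ · 1#)
      ≡⟨ cong₂ _*_ (fromℤ-sign-abs i) (fromℤ-sign-abs j) ⟨
    fromℤ i * fromℤ j                                                  ∎
    where
    fromℤ-sign-abs : ∀ i → fromℤ i ≡ fromSign (ℤ.sign i) * ℤ.∣ i ∣ · 1#
    fromℤ-sign-abs i = trans (cong fromℤ (sym (ℤ.◃-inverse i))) (fromℤ-◃ (ℤ.sign i) ℤ.∣ i ∣)

  fromℤ-homomorphism : ℤ.+-*-rawRing -Raw-AlmostCommutative⟶ fromCommutativeRing commutativeRing
  fromℤ-homomorphism = record
    { ⟦_⟧    = fromℤ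
    ; +-homo = fromℤ-+
    ; *-homo = fromℤ-*
    ; -‿homo = fromℤ-‿
    ; 0-homo = refl
    ; 1-homo = +-identityʳ 1#
    }

  fromℤ-≟ : ∀ i j → Maybe (fromℤ i ≡ fromℤ j)
  fromℤ-≟ i j with i ℤ.≟ j
  ... | yes i≡j = just (cong fromℤ i≡j)
  ... | no _    = nothing

  open Algebra.Solver.Ring ℤ.+-*-rawRing (fromCommutativeRing commutativeRing) fromℤ-homomorphism fromℤ-≟
    using (solve; _:=_; _:+_; _:*_; :-_; _:-_; con)

  _≟_ : (x y : Carrier) → Dec (x ≡ y)
  x ≟ y = map′ (Injection.injective (↔⇒↣ enumeration)) (cong (Inverse.to enumeration))
               (Inverse.to enumeration x Fin.≟ Inverse.to enumeration y)

  inv : (x : Carrier) → x ≢ 0# → Carrier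
  inv x x≢0 = proj₁ (inverse x x≢0)

  *-inverseʳ : ∀ x (x≢0 : x ≢ 0#) → x * inv x x≢0 ≡ 1#
  *-inverseʳ x x≢0 = proj₂ (inverse x x≢0)

  inv≢0 : ∀ x (x≢0 : x ≢ 0#) → inv x x≢0 ≢ 0#
  inv≢0 x x≢0 x⁻¹≡0 = 0≢1 (begin
    0#                  ≡⟨ zeroʳ x ⟨
    x * 0#              ≡⟨ cong (x *_) x⁻¹≡0 ⟨
    x * inv x x≢0       ≡⟨ *-inverseʳ x x≢0 ⟩
    1#                  ∎)

  x*y≡0⇒x≡0∨y≡0 : ∀ x {y} → x * y ≡ 0# → x ≡ 0# ⊎ y ≡ 0#
  x*y≡0⇒x≡0∨y≡0 x {y} xy≡0 with x ≟ 0#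
  ... | yes x≡0 = inj₁ x≡0
  ... | no  x≢0 = inj₂ (begin
    y                        ≡⟨ *-identityˡ y ⟨
    1# * y                   ≡⟨ cong (_* y) (*-inverseʳ x x≢0) ⟨
    (x * inv x x≢0) * y      ≡⟨ xy∙z≈xz∙y x (inv x x≢0) y ⟩
    (x * y) * inv x x≢0      ≡⟨ cong (_* inv x x≢0) xy≡0 ⟩
    0# * inv x x≢0           ≡⟨ zeroˡ _ ⟩
    0#                       ∎)

  x*y≢0 : ∀ {x y} → x ≢ 0# → y ≢ 0# → x * y ≢ 0#
  x*y≢0 {x} x≢0 y≢0 xy≡0 = [ x≢0 , y≢0 ]′ (x*y≡0⇒x≡0∨y≡0 x xy≡0)

  *-cancelˡ-≡ : ∀ {x y z} → x ≢ 0# → x * y ≡ x * z → y ≡ z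
  *-cancelˡ-≡ {x} {y} {z} x≢0 xy≡xz with x*y≡0⇒x≡0∨y≡0 x x[y-z]≡0
    where
    x[y-z]≡0 : x * (y - z) ≡ 0#
    x[y-z]≡0 = trans (x[y-z]≈xy-xz x y z) (trans (cong (_- x * z) xy≡xz) (-‿inverseʳ (x * z)))
  ... | inj₁ x≡0   = contradiction x≡0 x≢0
  ... | inj₂ y-z≡0 = x∙y⁻¹≈ε⇒x≈y y z y-z≡0

  x*y≡z⇒y≡x⁻¹*z : ∀ {x y z} (x≢0 : x ≢ 0#) → x * y ≡ z → y ≡ inv x x≢0 * z
  x*y≡z⇒y≡x⁻¹*z {x} {y} {z} x≢0 xy≡z = *-cancelˡ-≡ x≢0 (begin
    x * y                  ≡⟨ xy≡z ⟩
    z                      ≡⟨ *-identityˡ z ⟨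
    1# * z                 ≡⟨ cong (_* z) (*-inverseʳ x x≢0) ⟨
    (x * inv x x≢0) * z    ≡⟨ *-assoc x _ z ⟩
    x * (inv x x≢0 * z)    ∎)

  ^-zeroˡ : ∀ n → 1# ^ n ≡ 1#
  ^-zeroˡ zero    = refl
  ^-zeroˡ (suc n) = trans (*-identityˡ _) (^-zeroˡ n)

  ^-distribˡ-+-* : ∀ x m n → x ^ (m ℕ.+ n) ≡ x ^ m * x ^ n
  ^-distribˡ-+-* x zero    n = sym (*-identityˡ _)
  ^-distribˡ-+-* x (suc m) n = trans (cong (x *_) (^-distribˡ-+-* x m n)) (sym (*-assoc x _ _))

  ^-distribʳ-* : ∀ x y n → (x * y) ^ n ≡ x ^ n * y ^ n
  ^-distribʳ-* x y zero    = sym (*-identityˡ 1#)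
  ^-distribʳ-* x y (suc n) = trans (cong ((x * y) *_) (^-distribʳ-* x y n)) (*-interchange x y _ _)

  ^-*-assoc : ∀ x m n → (x ^ m) ^ n ≡ x ^ (m ℕ.* n)
  ^-*-assoc x zero    n = ^-zeroˡ n
  ^-*-assoc x (suc m) n = begin
    (x * x ^ m) ^ n          ≡⟨ ^-distribʳ-* x (x ^ m) n ⟩
    x ^ n * (x ^ m) ^ n      ≡⟨ cong (x ^ n *_) (^-*-assoc x m n) ⟩
    x ^ n * x ^ (m ℕ.* n)    ≡⟨ ^-distribˡ-+-* x n (m ℕ.* n) ⟨
    x ^ (n ℕ.+ m ℕ.* n)      ∎

  x^n≡0⇒x≡0 : ∀ x n → x ^ n ≡ 0# → x ≡ 0#
  x^n≡0⇒x≡0 x zero    1≡0  = contradiction (sym 1≡0) 0≢1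
  x^n≡0⇒x≡0 x (suc n) xxⁿ≡0 with x*y≡0⇒x≡0∨y≡0 x xxⁿ≡0
  ... | inj₁ x≡0  = x≡0
  ... | inj₂ xⁿ≡0 = x^n≡0⇒x≡0 x n xⁿ≡0

  x^n≢0 : ∀ {x} n → x ≢ 0# → x ^ n ≢ 0#
  x^n≢0 {x} n x≢0 xⁿ≡0 = x≢0 (x^n≡0⇒x≡0 x n xⁿ≡0)

  ^≡^ : ∀ x n → x ^ n ≡ x ^ₛ n
  ^≡^ x zero    = refl
  ^≡^ x (suc n) = cong (x *_) (^≡^ x n)

  module _ where
    open Sum +-commutativeMonoid using (sum; sum-permute; sum-cong-≗; ∑-distrib-+; sum-replicate)

    element : Fin size → Carrier
    element = Inverse.from enumeration

    index : Carrier → Fin size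
    index = Inverse.to enumeration

    translation : Carrier → Permutation size size
    translation c = permutation (λ j → index (element j + c)) (λ j → index (element j - c))
      (λ j → translate-back c (- c) j (solve 2 (λ x c → (x :- c) :+ c := x) refl (element j) c))
      (λ j → translate-back (- c) c j (solve 2 (λ x c → (x :+ c) :- c := x) refl (element j) c))
      where
      translate-back : ∀ c d j → (element j + d) + c ≡ element j → index (element (index (element j + d)) + c) ≡ j
      translate-back c d j back = begin
        index (element (index (element j + d)) + c)
          ≡⟨ cong (λ x → index (x + c)) (Inverse.strictlyInverseʳ enumeration _) ⟩
        index ((element j + d) + c)                  ≡⟨ cong index back ⟩
        index (element j)                            ≡⟨ Inverse.strictlyInverseˡ enumeration j ⟩
        j                                            ∎

    -- Translation by 1# permutes the field, so ∑ x = ∑ (x + 1#) = ∑ x + size · 1#.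
    size·1≡0 : size · 1# ≡ 0#
    size·1≡0 = sym (+-cancelˡ total 0# (size · 1#) (begin
      total + 0#                            ≡⟨ +-identityʳ total ⟩
      total                                 ≡⟨ sum-permute element (translation 1#) ⟩
      sum (λ j → element (index (element j + 1#)))
        ≡⟨ sum-cong-≗ (λ j → Inverse.strictlyInverseʳ enumeration (element j + 1#)) ⟩
      sum {size} (λ j → element j + 1#)     ≡⟨ ∑-distrib-+ element (λ _ → 1#) ⟩
      total + sum {size} (λ _ → 1#)         ≡⟨ cong (total +_) (sum-replicate size) ⟩
      total + size · 1#                     ∎))
      where
      total : Carrier
      total = sum element

  ^·1 : ∀ p m → (p ℕ.^ m) · 1# ≡ (p · 1#) ^ m
  ^·1 p zero    = +-identityʳ 1#
  ^·1 p (suc m) = trans (×1-homo-* p (p ℕ.^ m)) (cong ((p · 1#) *_) (^·1 p m))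

  size≡p^m⇒p·1≡0 : ∀ {p m} → size ≡ p ℕ.^ m → p · 1# ≡ 0#
  size≡p^m⇒p·1≡0 {p} {m} size≡p^m = x^n≡0⇒x≡0 (p · 1#) m (begin
    (p · 1#) ^ m      ≡⟨ ^·1 p m ⟨
    (p ℕ.^ m) · 1#    ≡⟨ cong (_· 1#) size≡p^m ⟨
    size · 1#         ≡⟨ size·1≡0 ⟩
    0#                ∎)

  p·1≡0∧p∣m⇒m·x≡0 : ∀ {p m} → p · 1# ≡ 0# → p ∣ m → ∀ x → m · x ≡ 0#
  p·1≡0∧p∣m⇒m·x≡0 {p} {m} p·1≡0 (divides d m≡dp) x = begin
    m · x                          ≡⟨ cong (m ·_) (*-identityˡ x) ⟨
    m · (1# * x)                   ≡⟨ ×-assoc-* m 1# x ⟨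
    (m · 1#) * x                   ≡⟨ cong (λ k → (k · 1#) * x) m≡dp ⟩
    ((d ℕ.* p) · 1#) * x           ≡⟨ cong (_* x) (×1-homo-* d p) ⟩
    ((d · 1#) * (p · 1#)) * x      ≡⟨ cong (λ z → ((d · 1#) * z) * x) p·1≡0 ⟩
    ((d · 1#) * 0#) * x            ≡⟨ trans (cong (_* x) (zeroʳ _)) (zeroˡ x) ⟩
    0#                             ∎

  Additive : ℕ → Set
  Additive e = ∀ x y → (x + y) ^ e ≡ x ^ e + y ^ e

  frobenius-additive : ∀ {p} → Prime p → p · 1# ≡ 0# → Additive p
  frobenius-additive {zero}  p-prime = contradiction refl (ℕ.≢-nonZero⁻¹ 0 {{prime⇒nonZero p-prime}})
  frobenius-additive {suc n} p-prime p·1≡0 x y = begin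
    (x + y) ^ p                                          ≡⟨ ^≡^ (x + y) p ⟩
    (x + y) ^ₛ p                                         ≡⟨ theorem p x y ⟩
    T Fin.zero + sum (T ∘ Fin.suc)                       ≡⟨ cong (T Fin.zero +_) (sum-init-last (T ∘ Fin.suc)) ⟩
    T Fin.zero + (sum (T ∘ Fin.suc ∘ inject₁) + T (fromℕ p))
      ≡⟨ cong (λ s → T Fin.zero + (s + T (fromℕ p))) (trans (sum-cong-≗ middle-term) (sum-replicate-zero n)) ⟩
    T Fin.zero + (0# + T (fromℕ p))
      ≡⟨ cong₂ (λ a b → a + (0# + b)) first-term (last-term (fromℕ p) (Fin.toℕ-fromℕ p)) ⟩
    y ^ p + (0# + x ^ p)                                 ≡⟨ cong ((y ^ p) +_) (+-identityˡ _) ⟩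
    y ^ p + x ^ p                                        ≡⟨ +-comm _ _ ⟩
    x ^ p + y ^ p                                        ∎
    where
    open Binomial commutativeSemiring using (theorem; binomialTerm)
    open Sum +-commutativeMonoid using (sum; sum-cong-≗; sum-init-last; sum-replicate-zero)
    p = suc n
    T : Fin (suc p) → Carrier
    T = binomialTerm x y p
    first-term : T Fin.zero ≡ y ^ p
    first-term = trans (+-identityʳ _) (trans (*-identityˡ _) (sym (^≡^ y p)))
    last-term : ∀ k → toℕ k ≡ p → T k ≡ x ^ p
    last-term k k≡p rewrite k≡p | nCn≡1 p | ℕ.n∸n≡0 p =
      trans (+-identityʳ _) (trans (*-identityʳ _) (sym (^≡^ x p)))
    middle-term : ∀ j → T (Fin.suc (inject₁ j)) ≡ 0#
    middle-term j = p·1≡0∧p∣m⇒m·x≡0 p·1≡0 (prime∣pC[1+k] (toℕ (inject₁ j)) p-prime (ℕ.s≤s (Fin.inject₁ℕ< j))) _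

  Additive-* : ∀ {a b} → Additive a → Additive b → Additive (a ℕ.* b)
  Additive-* {a} {b} a-additive b-additive x y = begin
    (x + y) ^ (a ℕ.* b)              ≡⟨ ^-*-assoc (x + y) a b ⟨
    ((x + y) ^ a) ^ b                ≡⟨ cong (_^ b) (a-additive x y) ⟩
    (x ^ a + y ^ a) ^ b              ≡⟨ b-additive _ _ ⟩
    (x ^ a) ^ b + (y ^ a) ^ b        ≡⟨ cong₂ _+_ (^-*-assoc x a b) (^-*-assoc y a b) ⟩
    x ^ (a ℕ.* b) + y ^ (a ℕ.* b)    ∎

  Additive-^ : ∀ {a} → Additive a → ∀ m → Additive (a ℕ.^ m)
  Additive-^ a-additive zero    x y = trans (*-identityʳ _) (sym (cong₂ _+_ (*-identityʳ x) (*-identityʳ y)))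
  Additive-^ {a} a-additive (suc m) = Additive-* {a} {a ℕ.^ m} a-additive (Additive-^ a-additive m)

  module _ {e} (e-additive : Additive e) where

    additive⇒0^e≡0 : 0# ^ e ≡ 0#
    additive⇒0^e≡0 = x+x≈x⇒x≈0 (0# ^ e) (sym (trans (cong (_^ e) (sym (+-identityʳ 0#))) (e-additive 0# 0#)))

    additive⇒[-x]^e≡-x^e : ∀ x → (- x) ^ e ≡ - (x ^ e)
    additive⇒[-x]^e≡-x^e x = +-inverseʳ-unique (x ^ e) ((- x) ^ e)
      (trans (sym (e-additive x (- x))) (trans (cong (_^ e) (-‿inverseʳ x)) additive⇒0^e≡0))

    additive⇒^e-injective : ∀ {x y} → x ^ e ≡ y ^ e → x ≡ y
    additive⇒^e-injective {x} {y} xᵉ≡yᵉ = x∙y⁻¹≈ε⇒x≈y x y (x^n≡0⇒x≡0 (x - y) e (begin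
      (x - y) ^ e              ≡⟨ e-additive x (- y) ⟩
      x ^ e + (- y) ^ e        ≡⟨ cong ((x ^ e) +_) (additive⇒[-x]^e≡-x^e y) ⟩
      x ^ e - y ^ e            ≡⟨ cong (_-_ (x ^ e)) xᵉ≡yᵉ ⟨
      x ^ e - x ^ e            ≡⟨ -‿inverseʳ (x ^ e) ⟩
      0#                       ∎))

  module Subfields (q : ℕ) (q^-additive : ∀ m → Additive (q ℕ.^ m)) where
    open FieldNotions F q

    infix 20 _^q^_
    _^q^_ : Carrier → ℕ → Carrier
    x ^q^ m = x ^ (q ℕ.^ m)

    ^q^-^q^ : ∀ x a b → (x ^q^ a) ^q^ b ≡ x ^q^ (a ℕ.+ b)
    ^q^-^q^ x a b = trans (^-*-assoc x (q ℕ.^ a) (q ℕ.^ b)) (cong (x ^_) (sym (ℕ.^-distribˡ-+-* q a b)))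

    ^q^-comm : ∀ x a b → (x ^q^ a) ^q^ b ≡ (x ^q^ b) ^q^ a
    ^q^-comm x a b = trans (^q^-^q^ x a b) (trans (cong (x ^q^_) (ℕ.+-comm a b)) (sym (^q^-^q^ x b a)))

    InSub-degree-0 : ∀ x → InSub 0 x
    InSub-degree-0 = *-identityʳ

    InSub-degree-+ : ∀ {a b x} → InSub a x → InSub b x → InSub (a ℕ.+ b) x
    InSub-degree-+ {a} {b} {x} x∈a x∈b = trans (sym (^q^-^q^ x a b)) (trans (cong (_^q^ b) x∈a) x∈b)

    InSub-degree-* : ∀ {a x} → InSub a x → ∀ k → InSub (k ℕ.* a) x
    InSub-degree-* {a} {x} x∈a zero    = InSub-degree-0 x
    InSub-degree-* {a} {x} x∈a (suc k) = InSub-degree-+ {a} {k ℕ.* a} x∈a (InSub-degree-* x∈a k)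

    InSub-degree-∸ : ∀ {a b x} → InSub (a ℕ.+ b) x → InSub b x → InSub a x
    InSub-degree-∸ {a} {b} {x} x∈a+b x∈b =
      additive⇒^e-injective {q ℕ.^ b} (q^-additive b) (trans (^q^-^q^ x a b) (trans x∈a+b (sym x∈b)))

    InSub-gcd : ∀ {a b x} → InSub a x → InSub b x → InSub (gcd a b) x
    InSub-gcd {a} {b} {x} x∈a x∈b with Bézout.identity (gcd-GCD a b)
    ... | Bézout.+- u v eq = InSub-degree-∸ {gcd a b} {v ℕ.* b}
            (subst (λ k → InSub k x) (sym eq) (InSub-degree-* x∈a u)) (InSub-degree-* x∈b v)
    ... | Bézout.-+ u v eq = InSub-degree-∸ {gcd a b} {u ℕ.* a}
            (subst (λ k → InSub k x) (sym eq) (InSub-degree-* x∈b v)) (InSub-degree-* x∈a u)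

    open Sum *-commutativeMonoid using ()
      renaming (sum to ∏; sum-permute to ∏-permute; sum-cong-≗ to ∏-cong-≗; sum-init-last to ∏-init-last)

    prod≡∏ : ∀ n f → prod n f ≡ ∏ {n} (f ∘ toℕ)
    prod≡∏ zero    f = refl
    prod≡∏ (suc n) f = begin
      prod n f * f n
        ≡⟨ cong₂ _*_ (trans (prod≡∏ n f) (∏-cong-≗ {n} (cong f ∘ sym ∘ Fin.toℕ-inject₁)))
            (cong f (sym (Fin.toℕ-fromℕ n))) ⟩
      ∏ {n} (f ∘ toℕ ∘ inject₁) * f (toℕ (fromℕ n)) ≡⟨ ∏-init-last {n} (f ∘ toℕ) ⟨
      ∏ {suc n} (f ∘ toℕ)                          ∎

    prod-reindex : ∀ n {t} → Coprime t n → (h : ℕ → Carrier) → (∀ j → h (j ℕ.+ n) ≡ h j) →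
                   {g : ℕ → Carrier} → (∀ j → g j ≡ h (t ℕ.* j)) → prod n g ≡ prod n h
    prod-reindex zero    _    _ _          _   = refl
    prod-reindex (suc n) {t} t⊥n h h-periodic {g} g≗h∘t* = begin
      prod N g                            ≡⟨ prod≡∏ N g ⟩
      ∏ {N} (g ∘ toℕ)
        ≡⟨ ∏-cong-≗ (λ j → trans (g≗h∘t* (toℕ j)) (trans (h-mod (t ℕ.* toℕ j)) (cong h (sym (toℕ-*% t j))))) ⟩
      ∏ {N} (λ j → h (toℕ (t *% j)))      ≡⟨ ∏-permute (h ∘ toℕ) (*%-permutation t⊥n) ⟨
      ∏ {N} (h ∘ toℕ)                     ≡⟨ prod≡∏ N h ⟨
      prod N h                            ∎
      where
      N = suc n
      h-shift : ∀ r k → h (r ℕ.+ k ℕ.* N) ≡ h r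
      h-shift r zero    = cong h (ℕ.+-identityʳ r)
      h-shift r (suc k) = begin
        h (r ℕ.+ (N ℕ.+ k ℕ.* N))
          ≡⟨ cong h (trans (cong (r ℕ.+_) (ℕ.+-comm N (k ℕ.* N))) (sym (ℕ.+-assoc r (k ℕ.* N) N))) ⟩
        h (r ℕ.+ k ℕ.* N ℕ.+ N)      ≡⟨ h-periodic (r ℕ.+ k ℕ.* N) ⟩
        h (r ℕ.+ k ℕ.* N)            ≡⟨ h-shift r k ⟩
        h r                          ∎
      h-mod : ∀ m → h m ≡ h (m % N)
      h-mod m = trans (cong h (m≡m%n+[m/n]*n m N)) (h-shift (m % N) (m / N))

    module Subfield (m : ℕ) where

      InSub-0# : InSub m 0#
      InSub-0# = additive⇒0^e≡0 {q ℕ.^ m} (q^-additive m)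

      InSub-1# : InSub m 1#
      InSub-1# = ^-zeroˡ (q ℕ.^ m)

      InSub-+ : ∀ {x y} → InSub m x → InSub m y → InSub m (x + y)
      InSub-+ {x} {y} x∈m y∈m = trans (q^-additive m x y) (cong₂ _+_ x∈m y∈m)

      InSub-neg : ∀ {x} → InSub m x → InSub m (- x)
      InSub-neg {x} x∈m = trans (additive⇒[-x]^e≡-x^e {q ℕ.^ m} (q^-additive m) x) (cong -_ x∈m)

      InSub-- : ∀ {x y} → InSub m x → InSub m y → InSub m (x - y)
      InSub-- x∈m y∈m = InSub-+ x∈m (InSub-neg y∈m)

      InSub-* : ∀ {x y} → InSub m x → InSub m y → InSub m (x * y)
      InSub-* {x} {y} x∈m y∈m = trans (^-distribʳ-* x y (q ℕ.^ m)) (cong₂ _*_ x∈m y∈m)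

      InSub-inv : ∀ {x} (x≢0 : x ≢ 0#) → InSub m x → InSub m (inv x x≢0)
      InSub-inv {x} x≢0 x∈m = *-cancelˡ-≡ x≢0 (begin
        x * x⁻¹ ^q^ m              ≡⟨ cong (_* x⁻¹ ^q^ m) x∈m ⟨
        x ^q^ m * x⁻¹ ^q^ m        ≡⟨ ^-distribʳ-* x x⁻¹ (q ℕ.^ m) ⟨
        (x * x⁻¹) ^q^ m            ≡⟨ cong (_^q^ m) (*-inverseʳ x x≢0) ⟩
        1# ^q^ m                   ≡⟨ ^-zeroˡ (q ℕ.^ m) ⟩
        1#                         ≡⟨ *-inverseʳ x x≢0 ⟨
        x * x⁻¹                    ∎)
        where
        x⁻¹ = inv x x≢0

      InSub-^q^ : ∀ {x} j → InSub m x → InSub m (x ^q^ j)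
      InSub-^q^ {x} j x∈m = trans (^q^-comm x j m) (cong (_^q^ j) x∈m)

      InSub-prod : ∀ k {f} → (∀ j → InSub m (f j)) → InSub m (prod k f)
      InSub-prod zero    f∈m = InSub-1#
      InSub-prod (suc k) f∈m = InSub-* (InSub-prod k f∈m) (f∈m k)

      ^q^-+ : ∀ x y → (x + y) ^q^ m ≡ x ^q^ m + y ^q^ m
      ^q^-+ = q^-additive m

      ^q^-* : ∀ x y → (x * y) ^q^ m ≡ x ^q^ m * y ^q^ m
      ^q^-* x y = ^-distribʳ-* x y (q ℕ.^ m)

      affine-root-InSub : ∀ {α β y} → InSub m α → InSub m β → α ≢ 0# → α * y + β ≡ 0# → InSub m y
      affine-root-InSub {α} {β} {y} α∈m β∈m α≢0 root = *-cancelˡ-≡ α≢0 (+-cancelʳ β (α * y ^q^ m) (α * y) (begin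
        α * y ^q^ m + β                    ≡⟨ cong₂ (λ u v → u * y ^q^ m + v) α∈m β∈m ⟨
        α ^q^ m * y ^q^ m + β ^q^ m        ≡⟨ trans (^q^-+ (α * y) β) (cong (_+ β ^q^ m) (^q^-* α y)) ⟨
        (α * y + β) ^q^ m                  ≡⟨ cong (_^q^ m) root ⟩
        0# ^q^ m                           ≡⟨ InSub-0# ⟩
        0#                                 ≡⟨ root ⟨
        α * y + β                          ∎))

      quadratic-root-^q^ : ∀ {α β γ x} → InSub m α → InSub m β → InSub m γ →
        α * (x * x) + β * x + γ ≡ 0# → α * (x ^q^ m * x ^q^ m) + β * x ^q^ m + γ ≡ 0#
      quadratic-root-^q^ {α} {β} {γ} {x} α∈m β∈m γ∈m root = begin
        α * (x′ * x′) + β * x′ + γ                               ≡⟨ cong (α * (x′ * x′) + β * x′ +_) γ∈m ⟨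
        α * (x′ * x′) + β * x′ + γ ^q^ m
          ≡⟨ cong₂ (λ u v → u * (x′ * x′) + v * x′ + γ ^q^ m) α∈m β∈m ⟨
        α ^q^ m * (x′ * x′) + β ^q^ m * x′ + γ ^q^ m
          ≡⟨ cong₂ (λ u v → u + v + γ ^q^ m) (trans (^q^-* α (x * x)) (cong (α ^q^ m *_) (^q^-* x x))) (^q^-* β x) ⟨
        (α * (x * x)) ^q^ m + (β * x) ^q^ m + γ ^q^ m           ≡⟨ trans (^q^-+ _ γ) (cong (_+ γ ^q^ m) (^q^-+ _ _)) ⟨
        (α * (x * x) + β * x + γ) ^q^ m                         ≡⟨ cong (_^q^ m) root ⟩
        0# ^q^ m                                                ≡⟨ InSub-0# ⟩
        0#                                                      ∎
        where
        x′ = x ^q^ m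

      -- x and x′ = x ^q^ m are both roots, so (x - x′) (α (x + x′) + β) = 0; and if x + x′ lies
      -- in F_{q^m} then x′ + x ^q^ (m + m) = x + x′.
      quadratic-root⇒InSub-2m : ∀ {α β γ x} → InSub m α → InSub m β → InSub m γ → α ≢ 0# →
        α * (x * x) + β * x + γ ≡ 0# → InSub (m ℕ.+ m) x
      quadratic-root⇒InSub-2m {α} {β} {γ} {x} α∈m β∈m γ∈m α≢0 root =
        [ conjugates-equal , sum-in-subfield ]′ (x*y≡0⇒x≡0∨y≡0 (x - x′) factored)
        where
        x′ = x ^q^ m
        factored : (x - x′) * (α * (x + x′) + β) ≡ 0#
        factored = begin
          (x - x′) * (α * (x + x′) + β)
            ≡⟨ solve 5 (λ x x′ α β γ → (x :- x′) :* (α :* (x :+ x′) :+ β)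
                            := (α :* (x :* x) :+ β :* x :+ γ) :- (α :* (x′ :* x′) :+ β :* x′ :+ γ)) refl x x′ α β γ ⟩
          (α * (x * x) + β * x + γ) - (α * (x′ * x′) + β * x′ + γ)
            ≡⟨ cong₂ _-_ root (quadratic-root-^q^ α∈m β∈m γ∈m root) ⟩
          0# - 0#
            ≡⟨ -‿inverseʳ 0# ⟩
          0# ∎
        conjugates-equal : x - x′ ≡ 0# → InSub (m ℕ.+ m) x
        conjugates-equal x-x′≡0 = InSub-degree-+ {m} {m} x∈m x∈m
          where x∈m = sym (x∙y⁻¹≈ε⇒x≈y x x′ x-x′≡0)
        sum-in-subfield : α * (x + x′) + β ≡ 0# → InSub (m ℕ.+ m) x
        sum-in-subfield linear≡0 = +-cancelˡ x′ _ _ (begin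
          x′ + x ^q^ (m ℕ.+ m)     ≡⟨ cong (x′ +_) (^q^-^q^ x m m) ⟨
          x′ + x′ ^q^ m            ≡⟨ ^q^-+ x x′ ⟨
          (x + x′) ^q^ m           ≡⟨ affine-root-InSub α∈m β∈m α≢0 linear≡0 ⟩
          x + x′                   ≡⟨ +-comm x x′ ⟩
          x′ + x                   ∎)

    module Semilinear (a : Carrier) (i : ℕ) where
      open Subfield i using (^q^-+; ^q^-*)

      Φ : Carrier → Carrier
      Φ z = a * z ^q^ i

      Φ-semilinear : ∀ c x d y → Φ (c * x + d * y) ≡ c ^q^ i * Φ x + d ^q^ i * Φ y
      Φ-semilinear c x d y = begin
        a * (c * x + d * y) ^q^ i
          ≡⟨ cong (a *_) (trans (^q^-+ _ _) (cong₂ _+_ (^q^-* c x) (^q^-* d y))) ⟩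
        a * (c ^q^ i * x ^q^ i + d ^q^ i * y ^q^ i)        ≡⟨ solve 5 (λ a c′ x′ d′ y′ → a :* (c′ :* x′ :+ d′ :* y′)
                                                                  := c′ :* (a :* x′) :+ d′ :* (a :* y′)) refl a _ _ _ _ ⟩
        c ^q^ i * (a * x ^q^ i) + d ^q^ i * (a * y ^q^ i)  ∎

      Φ-* : ∀ x y → Φ (x * y) ≡ Φ x * y ^q^ i
      Φ-* x y = trans (cong (a *_) (^q^-* x y)) (sym (*-assoc a _ _))

      ^q^-i* : ∀ x k → (x ^q^ (i ℕ.* k)) ^q^ i ≡ x ^q^ (i ℕ.* suc k)
      ^q^-i* x k = trans (^q^-^q^ x (i ℕ.* k) i) (cong (x ^q^_) (trans (ℕ.+-comm (i ℕ.* k) i) (sym (ℕ.*-suc i k))))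

      x≡1*x^q^[i*0] : ∀ x → x ≡ 1# * x ^q^ (i ℕ.* 0)
      x≡1*x^q^[i*0] x = sym (trans (*-identityˡ _) (trans (cong (x ^q^_) (ℕ.*-zeroʳ i)) (InSub-degree-0 x)))

      norm : ℕ → Carrier
      norm k = prod k (λ j → a ^q^ (i ℕ.* j))

      Φ-norm : ∀ k → Φ (norm k) ≡ norm (suc k)
      Φ-norm zero    = trans (cong (a *_) (^-zeroˡ (q ℕ.^ i))) (trans (*-identityʳ a) (x≡1*x^q^[i*0] a))
      Φ-norm (suc k) = begin
        Φ (norm k * a ^q^ (i ℕ.* k))               ≡⟨ Φ-* (norm k) _ ⟩
        Φ (norm k) * (a ^q^ (i ℕ.* k)) ^q^ i       ≡⟨ cong₂ _*_ (Φ-norm k) (^q^-i* a k) ⟩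
        norm (suc k) * a ^q^ (i ℕ.* suc k)         ∎

      fold-Φ : ∀ k w → fold w Φ k ≡ norm k * w ^q^ (i ℕ.* k)
      fold-Φ zero    w = x≡1*x^q^[i*0] w
      fold-Φ (suc k) w = begin
        Φ (fold w Φ k)                             ≡⟨ cong Φ (fold-Φ k w) ⟩
        Φ (norm k * w ^q^ (i ℕ.* k))               ≡⟨ Φ-* (norm k) _ ⟩
        Φ (norm k) * (w ^q^ (i ℕ.* k)) ^q^ i       ≡⟨ cong₂ _*_ (Φ-norm k) (^q^-i* w k) ⟩
        norm (suc k) * w ^q^ (i ℕ.* suc k)         ∎

      module Span (m : ℕ) (x : Carrier) where
        open Subfield m

        InSpan : Carrier → Set
        InSpan w = Σ Carrier λ c → Σ Carrier λ d → InSub m c × InSub m d × w ≡ c * x + d * Φ x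

        Φ-preserves-InSpan : InSpan (Φ (Φ x)) → ∀ {w} → InSpan w → InSpan (Φ w)
        Φ-preserves-InSpan (b , c , b∈m , c∈m , Φ²x≡) {w} (d , e , d∈m , e∈m , w≡) =
          e′ * b , d′ + e′ * c , InSub-* e′∈m b∈m , InSub-+ (InSub-^q^ i d∈m) (InSub-* e′∈m c∈m) , (begin
            Φ w                                    ≡⟨ cong Φ w≡ ⟩
            Φ (d * x + e * Φ x)                    ≡⟨ Φ-semilinear d x e (Φ x) ⟩
            d′ * Φ x + e′ * Φ (Φ x)                ≡⟨ cong (λ z → d′ * Φ x + e′ * z) Φ²x≡ ⟩
            d′ * Φ x + e′ * (b * x + c * Φ x)      ≡⟨ solve 6 (λ b c d′ e′ x v → d′ :* v :+ e′ :* (b :* x :+ c :* v)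
                                                          := (e′ :* b) :* x :+ (d′ :+ e′ :* c) :* v) refl b c d′ e′ x (Φ x) ⟩
            (e′ * b) * x + (d′ + e′ * c) * Φ x     ∎)
          where
          d′ = d ^q^ i
          e′ = e ^q^ i
          e′∈m = InSub-^q^ i e∈m

        fold-Φ-InSpan : InSpan (Φ (Φ x)) → ∀ k → InSpan (fold x Φ k)
        fold-Φ-InSpan Φ²x∈ zero    = 1# , 0# , InSub-1# , InSub-0# ,
          sym (trans (cong₂ _+_ (*-identityˡ x) (zeroˡ (Φ x))) (+-identityʳ x))
        fold-Φ-InSpan Φ²x∈ (suc k) = Φ-preserves-InSpan Φ²x∈ (fold-Φ-InSpan Φ²x∈ k)

        InSpan-Φ² : ∀ {w c d} → InSub m c → InSub m d → d ≢ 0# → w ≡ c * x + d * Φ x → InSpan (Φ w) → InSpan (Φ (Φ x))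
        InSpan-Φ² {w} {c} {d} c∈m d∈m d≢0 w≡ (c₁ , d₁ , c₁∈m , d₁∈m , Φw≡) =
          e * c₁ , e * (d₁ - c′) , InSub-* e∈m c₁∈m , InSub-* e∈m (InSub-- d₁∈m (InSub-^q^ i c∈m)) , (begin
            Φ (Φ x)                                ≡⟨ x*y≡z⇒y≡x⁻¹*z d′≢0 d′Φ²x≡ ⟩
            e * (c₁ * x + (d₁ - c′) * Φ x)
              ≡⟨ solve 5 (λ e c₁ x d v → e :* (c₁ :* x :+ d :* v) := (e :* c₁) :* x :+ (e :* d) :* v)
                  refl e c₁ x (d₁ - c′) (Φ x) ⟩
            (e * c₁) * x + (e * (d₁ - c′)) * Φ x   ∎)
          where
          c′ = c ^q^ i
          d′ = d ^q^ i
          d′≢0 = x^n≢0 (q ℕ.^ i) d≢0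
          e = inv d′ d′≢0
          e∈m = InSub-inv d′≢0 (InSub-^q^ i d∈m)
          d′Φ²x≡ : d′ * Φ (Φ x) ≡ c₁ * x + (d₁ - c′) * Φ x
          d′Φ²x≡ = begin
            d′ * Φ (Φ x)
              ≡⟨ solve 4 (λ c′ d′ u v → d′ :* u := (c′ :* v :+ d′ :* u) :- c′ :* v) refl c′ d′ (Φ (Φ x)) (Φ x) ⟩
            (c′ * Φ x + d′ * Φ (Φ x)) - c′ * Φ x
              ≡⟨ cong (_- c′ * Φ x) (trans (sym (Φ-semilinear c x d (Φ x))) (trans (cong Φ (sym w≡)) Φw≡)) ⟩
            (c₁ * x + d₁ * Φ x) - c′ * Φ x
              ≡⟨ solve 5 (λ c₁ x d₁ c′ v → (c₁ :* x :+ d₁ :* v) :- c′ :* v := c₁ :* x :+ (d₁ :- c′) :* v)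
                  refl c₁ x d₁ c′ (Φ x) ⟩
            c₁ * x + (d₁ - c′) * Φ x               ∎

    module ScatteredLinearSet
      (n : ℕ) (3∤n : 3 ∤ n)
      (ω : Carrier) (ω∈L : InSub (2 ℕ.* n) ω) (ω∉Fqⁿ : ¬ InSub n ω)
      (a : Carrier) (a∈K : InSub (3 ℕ.* n) a) (a≢0 : a ≢ 0#)
      (i : ℕ) (gcd[i,2n]≡1 : gcd i (2 ℕ.* n) ≡ 1) (gcd[i,3n]≡3 : gcd i (3 ℕ.* n) ≡ 3)
      (norm3∉Fq : ¬ InSub 1 (norm3 n a))
      where

      open Semilinear a i
      module K = Subfield (3 ℕ.* n)
      module L = Subfield (2 ℕ.* n)
      open Span (2 ℕ.* n)

      f : Carrier → Carrier
      f = fmap a i ω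

      conj : Carrier → Carrier
      conj z = z ^q^ (3 ℕ.* n)

      ω̄ δ : Carrier
      ω̄ = conj ω
      δ = ω - ω̄

      δ∈L : InSub (2 ℕ.* n) δ
      δ∈L = L.InSub-- ω∈L (L.InSub-^q^ (3 ℕ.* n) ω∈L)

      δ≢0 : δ ≢ 0#
      δ≢0 δ≡0 = ω∉Fqⁿ (subst (λ k → InSub k ω) (gcd[3n,2n]≡n n)
        (InSub-gcd {3 ℕ.* n} {2 ℕ.* n} (sym (x∙y⁻¹≈ε⇒x≈y ω ω̄ δ≡0)) ω∈L))

      conj-f : ∀ {z} → InSub (3 ℕ.* n) z → conj (f z) ≡ Φ z + z * ω̄
      conj-f {z} z∈K = begin
        conj (a * z ^q^ i + z * ω)                   ≡⟨ K.^q^-+ _ _ ⟩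
        conj (a * z ^q^ i) + conj (z * ω)            ≡⟨ cong₂ _+_ (K.^q^-* a _) (K.^q^-* z ω) ⟩
        conj a * conj (z ^q^ i) + conj z * ω̄         ≡⟨ cong₂ (λ u v → u * v + conj z * ω̄) a∈K (K.InSub-^q^ i z∈K) ⟩
        a * z ^q^ i + conj z * ω̄                     ≡⟨ cong (λ u → a * z ^q^ i + u * ω̄) z∈K ⟩
        Φ z + z * ω̄                                  ∎

      δ*z≡f-f̄ : ∀ {z} → InSub (3 ℕ.* n) z → δ * z ≡ f z - conj (f z)
      δ*z≡f-f̄ {z} z∈K = begin
        (ω - ω̄) * z
          ≡⟨ solve 4 (λ ω ω̄ z v → (ω :- ω̄) :* z := (v :+ z :* ω) :- (v :+ z :* ω̄)) refl ω ω̄ z (Φ z) ⟩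
        (Φ z + z * ω) - (Φ z + z * ω̄)               ≡⟨ cong (_-_ (f z)) (conj-f z∈K) ⟨
        f z - conj (f z)                            ∎

      δ*Φz≡ωf̄-ω̄f : ∀ {z} → InSub (3 ℕ.* n) z → δ * Φ z ≡ ω * conj (f z) - ω̄ * f z
      δ*Φz≡ωf̄-ω̄f {z} z∈K = begin
        (ω - ω̄) * Φ z
          ≡⟨ solve 4 (λ ω ω̄ z v → (ω :- ω̄) :* v := ω :* (v :+ z :* ω̄) :- ω̄ :* (v :+ z :* ω)) refl ω ω̄ z (Φ z) ⟩
        ω * (Φ z + z * ω̄) - ω̄ * (Φ z + z * ω)       ≡⟨ cong (λ u → ω * u - ω̄ * f z) (conj-f z∈K) ⟨
        ω * conj (f z) - ω̄ * f z                    ∎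

      f-injective : HasRank3n n f
      f-injective x y x∈K y∈K fx≡fy = *-cancelˡ-≡ δ≢0 (begin
        δ * x                   ≡⟨ δ*z≡f-f̄ x∈K ⟩
        f x - conj (f x)        ≡⟨ cong (λ u → u - conj u) fx≡fy ⟩
        f y - conj (f y)        ≡⟨ δ*z≡f-f̄ y∈K ⟨
        δ * y                   ∎)

      3∣i : 3 ∣ i
      3∣i = subst (_∣ i) gcd[i,3n]≡3 (gcd[m,n]∣m i (3 ℕ.* n))

      t : ℕ
      t = _∣_.quotient 3∣i

      i≡t*3 : i ≡ t ℕ.* 3
      i≡t*3 = _∣_.equality 3∣i

      t⊥n : Coprime t n
      t⊥n = coprime-∣ (divides 3 (trans i≡t*3 (ℕ.*-comm t 3))) (divides 2 refl) (gcd≡1⇒coprime gcd[i,2n]≡1)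

      K⊆Fq^in : ∀ {z} → InSub (3 ℕ.* n) z → InSub (i ℕ.* n) z
      K⊆Fq^in {z} z∈K = subst (λ k → InSub k z) (sym (trans (cong (ℕ._* n) i≡t*3) (ℕ.*-assoc t 3 n)))
        (InSub-degree-* z∈K t)

      N : Carrier
      N = norm n

      N≡norm3 : N ≡ norm3 n a
      N≡norm3 = prod-reindex n t⊥n (λ j → a ^q^ (3 ℕ.* j)) a^q^3j-periodic
        (λ j → cong (a ^q^_) (trans (cong (ℕ._* j) i≡t*3) (*3-comm t j)))
        where
        *3-comm : ∀ t j → t ℕ.* 3 ℕ.* j ≡ 3 ℕ.* (t ℕ.* j)
        *3-comm = solve-∀
        a^q^3j-periodic : ∀ j → a ^q^ (3 ℕ.* (j ℕ.+ n)) ≡ a ^q^ (3 ℕ.* j)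
        a^q^3j-periodic j = begin
          a ^q^ (3 ℕ.* (j ℕ.+ n))             ≡⟨ cong (a ^q^_) (ℕ.*-distribˡ-+ 3 j n) ⟩
          a ^q^ (3 ℕ.* j ℕ.+ 3 ℕ.* n)         ≡⟨ ^q^-^q^ a (3 ℕ.* j) (3 ℕ.* n) ⟨
          (a ^q^ (3 ℕ.* j)) ^q^ (3 ℕ.* n)     ≡⟨ K.InSub-^q^ (3 ℕ.* j) a∈K ⟩
          a ^q^ (3 ℕ.* j)                     ∎

      N∈K : InSub (3 ℕ.* n) N
      N∈K = K.InSub-prod n (λ j → K.InSub-^q^ (i ℕ.* j) a∈K)

      fold-Φ-K : ∀ {w} → InSub (3 ℕ.* n) w → fold w Φ n ≡ N * w
      fold-Φ-K {w} w∈K = trans (fold-Φ n w) (cong (N *_) (K⊆Fq^in w∈K))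

      N∈Fq³ : InSub 3 N
      N∈Fq³ = subst (λ k → InSub k N) gcd[i,3n]≡3 (InSub-gcd {i} {3 ℕ.* n} N∈Fqⁱ N∈K)
        where
        N∈Fqⁱ : InSub i N
        N∈Fqⁱ = *-cancelˡ-≡ a≢0 (begin
          Φ N                       ≡⟨ Φ-norm n ⟩
          N * a ^q^ (i ℕ.* n)       ≡⟨ cong (N *_) (K⊆Fq^in a∈K) ⟩
          N * a                     ≡⟨ *-comm N a ⟩
          a * N                     ∎)

      N∉Fq⁴ⁿ : ¬ InSub (2 ℕ.* n ℕ.+ 2 ℕ.* n) N
      N∉Fq⁴ⁿ N∈Fq⁴ⁿ = norm3∉Fq (subst (InSub 1) N≡norm3
        (subst (λ k → InSub k N) gcd[3,4n]≡1 (InSub-gcd {3} {2 ℕ.* n ℕ.+ 2 ℕ.* n} N∈Fq³ N∈Fq⁴ⁿ)))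
        where
        3-prime : Prime 3
        3-prime = from-yes (prime? 3)
        gcd[3,4n]≡1 : gcd 3 (2 ℕ.* n ℕ.+ 2 ℕ.* n) ≡ 1
        gcd[3,4n]≡1 = prime∤⇒gcd≡1 3-prime
          (subst (3 ∤_) (ℕ.*-distribʳ-+ n 2 2) (prime∤-* 3-prime (from-no (3 ∣? 4)) 3∤n))

      InSpan-N⇒N∈Fq⁴ⁿ : ∀ {x} → x ≢ 0# → InSpan x (N * x) → InSpan x (N * (N * x)) →
                        InSub (2 ℕ.* n ℕ.+ 2 ℕ.* n) N
      InSpan-N⇒N∈Fq⁴ⁿ {x} x≢0 (c₁ , d₁ , c₁∈L , d₁∈L , Nx≡) (c₂ , d₂ , c₂∈L , d₂∈L , NNx≡) with d₁ ≟ 0#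
      ... | yes d₁≡0 = InSub-degree-+ {2 ℕ.* n} {2 ℕ.* n} N∈L N∈L
        where
        N≡c₁ : N ≡ c₁
        N≡c₁ = *-cancelˡ-≡ x≢0 (begin
          x * N                    ≡⟨ *-comm x N ⟩
          N * x                    ≡⟨ Nx≡ ⟩
          c₁ * x + d₁ * Φ x        ≡⟨ cong (λ d → c₁ * x + d * Φ x) d₁≡0 ⟩
          c₁ * x + 0# * Φ x        ≡⟨ trans (cong (c₁ * x +_) (zeroˡ (Φ x))) (+-identityʳ _) ⟩
          c₁ * x                   ≡⟨ *-comm c₁ x ⟩
          x * c₁                   ∎)
        N∈L : InSub (2 ℕ.* n) N
        N∈L = subst (InSub (2 ℕ.* n)) (sym N≡c₁) c₁∈L
      ... | no d₁≢0 = L.quadratic-root⇒InSub-2m d₁∈L (L.InSub-neg d₂∈L)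
                        (L.InSub-- (L.InSub-* d₂∈L c₁∈L) (L.InSub-* c₂∈L d₁∈L)) d₁≢0 N-root
        where
        N-root : d₁ * (N * N) + - d₂ * N + (d₂ * c₁ - c₂ * d₁) ≡ 0#
        N-root = [ id , (λ x≡0 → contradiction x≡0 x≢0) ]′ (x*y≡0⇒x≡0∨y≡0 _ (begin
          (d₁ * (N * N) + - d₂ * N + (d₂ * c₁ - c₂ * d₁)) * x
            ≡⟨ solve 6 (λ d₁ d₂ c₁ c₂ N x → (d₁ :* (N :* N) :+ :- d₂ :* N :+ (d₂ :* c₁ :- c₂ :* d₁)) :* x
                 := d₁ :* (N :* (N :* x)) :- d₂ :* (N :* x) :+ (d₂ :* c₁ :- c₂ :* d₁) :* x) refl d₁ d₂ c₁ c₂ N x ⟩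
          d₁ * (N * (N * x)) - d₂ * (N * x) + (d₂ * c₁ - c₂ * d₁) * x
            ≡⟨ cong₂ (λ u v → d₁ * u - d₂ * v + (d₂ * c₁ - c₂ * d₁) * x) NNx≡ Nx≡ ⟩
          d₁ * (c₂ * x + d₂ * Φ x) - d₂ * (c₁ * x + d₁ * Φ x) + (d₂ * c₁ - c₂ * d₁) * x
            ≡⟨ solve 6 (λ d₁ d₂ c₁ c₂ x v → d₁ :* (c₂ :* x :+ d₂ :* v) :- d₂ :* (c₁ :* x :+ d₁ :* v) :+ (d₂ :* c₁ :- c₂ :* d₁) :* x
                 := con (ℤ.+ 0)) refl d₁ d₂ c₁ c₂ x (Φ x) ⟩
          0#                                                                             ∎))

      Φ²x∉InSpan : ∀ {x} → x ≢ 0# → InSub (3 ℕ.* n) x → ¬ InSpan x (Φ (Φ x))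
      Φ²x∉InSpan {x} x≢0 x∈K Φ²x∈ = N∉Fq⁴ⁿ (InSpan-N⇒N∈Fq⁴ⁿ x≢0
        (subst (InSpan x) (fold-Φ-K x∈K) (fold-Φ-InSpan x Φ²x∈ n))
        (subst (InSpan x) fold-Φ-2n (fold-Φ-InSpan x Φ²x∈ (n ℕ.+ n))))
        where
        fold-Φ-2n : fold x Φ (n ℕ.+ n) ≡ N * (N * x)
        fold-Φ-2n = begin
          fold x Φ (n ℕ.+ n)       ≡⟨ fold-+ x Φ n ⟩
          fold (fold x Φ n) Φ n    ≡⟨ cong (λ w → fold w Φ n) (fold-Φ-K x∈K) ⟩
          fold (N * x) Φ n         ≡⟨ fold-Φ-K (K.InSub-* N∈K x∈K) ⟩
          N * (N * x)              ∎

      x≢0⇒Φx≢0 : ∀ {x} → x ≢ 0# → Φ x ≢ 0#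
      x≢0⇒Φx≢0 x≢0 = x*y≢0 a≢0 (x^n≢0 (q ℕ.^ i) x≢0)

      fx≢0⇒x≢0 : ∀ {x} → f x ≢ 0# → x ≢ 0#
      fx≢0⇒x≢0 fx≢0 refl = fx≢0 (begin
        a * 0# ^q^ i + 0# * ω    ≡⟨ cong₂ _+_ (trans (cong (a *_) (Subfield.InSub-0# i)) (zeroʳ a)) (zeroˡ ω) ⟩
        0# + 0#                  ≡⟨ +-identityʳ 0# ⟩
        0#                       ∎)

      conj-fixed-scalar∈Fq : ∀ {x y λ′} → InSub (3 ℕ.* n) x → x ≢ 0# → InSub (3 ℕ.* n) y →
        InSub (2 ℕ.* n) λ′ → conj λ′ ≡ λ′ → f y ≡ λ′ * f x → InSub 1 λ′
      conj-fixed-scalar∈Fq {x} {y} {λ′} x∈K x≢0 y∈K λ′∈L λ̄′≡λ′ fy≡λ′fx =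
        subst (λ k → InSub k λ′) gcd[i,2n]≡1 (InSub-gcd {i} {2 ℕ.* n} λ′∈Fqⁱ λ′∈L)
        where
        y≡xλ′ : y ≡ x * λ′
        y≡xλ′ = *-cancelˡ-≡ δ≢0 (begin
          δ * y                              ≡⟨ δ*z≡f-f̄ y∈K ⟩
          f y - conj (f y)                   ≡⟨ cong (λ u → u - conj u) fy≡λ′fx ⟩
          λ′ * f x - conj (λ′ * f x)
            ≡⟨ cong (_-_ (λ′ * f x)) (trans (K.^q^-* λ′ (f x)) (cong (_* conj (f x)) λ̄′≡λ′)) ⟩
          λ′ * f x - λ′ * conj (f x)         ≡⟨ x[y-z]≈xy-xz λ′ _ _ ⟨
          λ′ * (f x - conj (f x))            ≡⟨ cong (λ′ *_) (δ*z≡f-f̄ x∈K) ⟨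
          λ′ * (δ * x)                       ≡⟨ solve 3 (λ l d x → l :* (d :* x) := d :* (x :* l)) refl λ′ δ x ⟩
          δ * (x * λ′)                       ∎)
        λ′∈Fqⁱ : InSub i λ′
        λ′∈Fqⁱ = *-cancelˡ-≡ (x≢0⇒Φx≢0 x≢0) (+-cancelʳ ((x * λ′) * ω) _ _ (begin
          Φ x * λ′ ^q^ i + (x * λ′) * ω      ≡⟨ cong (_+ (x * λ′) * ω) (Φ-* x λ′) ⟨
          f (x * λ′)                         ≡⟨ cong f y≡xλ′ ⟨
          f y                                ≡⟨ fy≡λ′fx ⟩
          λ′ * (Φ x + x * ω)
            ≡⟨ solve 4 (λ l v x ω → l :* (v :+ x :* ω) := v :* l :+ (x :* l) :* ω) refl λ′ (Φ x) x ω ⟩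
          Φ x * λ′ + (x * λ′) * ω            ∎))

      δ⁻¹ : Carrier
      δ⁻¹ = inv δ δ≢0

      δ⁻¹∈L : InSub (2 ℕ.* n) δ⁻¹
      δ⁻¹∈L = L.InSub-inv δ≢0 δ∈L

      divide-by-δ : ∀ {x w P Q} → δ * w ≡ P * x + Q * Φ x → w ≡ (δ⁻¹ * P) * x + (δ⁻¹ * Q) * Φ x
      divide-by-δ {x} {w} {P} {Q} δw≡ = begin
        w                                  ≡⟨ x*y≡z⇒y≡x⁻¹*z δ≢0 δw≡ ⟩
        δ⁻¹ * (P * x + Q * Φ x)
          ≡⟨ solve 5 (λ e P x Q v → e :* (P :* x :+ Q :* v) := (e :* P) :* x :+ (e :* Q) :* v)
              refl δ⁻¹ P x Q (Φ x) ⟩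
        (δ⁻¹ * P) * x + (δ⁻¹ * Q) * Φ x    ∎

      conj-moved-scalar⇒Φ²x∈InSpan : ∀ {x y λ′} → InSub (3 ℕ.* n) x → InSub (3 ℕ.* n) y →
        InSub (2 ℕ.* n) λ′ → λ′ ≢ conj λ′ → f y ≡ λ′ * f x → InSpan x (Φ (Φ x))
      conj-moved-scalar⇒Φ²x∈InSpan {x} {y} {λ′} x∈K y∈K λ′∈L λ′≢λ̄′ fy≡λ′fx =
        InSpan-Φ² x (L.InSub-* δ⁻¹∈L P∈L) (L.InSub-* δ⁻¹∈L Q∈L) (x*y≢0 (inv≢0 δ δ≢0) Q≢0) (divide-by-δ δy≡)
          (δ⁻¹ * P′ , δ⁻¹ * Q′ , L.InSub-* δ⁻¹∈L P′∈L , L.InSub-* δ⁻¹∈L Q′∈L , divide-by-δ δΦy≡)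
        where
        λ̄′ = conj λ′
        λ̄′∈L = L.InSub-^q^ (3 ℕ.* n) λ′∈L
        ω̄∈L = L.InSub-^q^ (3 ℕ.* n) ω∈L
        P = λ′ * ω - λ̄′ * ω̄
        Q = λ′ - λ̄′
        P′ = (λ̄′ - λ′) * (ω * ω̄)
        Q′ = ω * λ̄′ - ω̄ * λ′
        P∈L = L.InSub-- (L.InSub-* λ′∈L ω∈L) (L.InSub-* λ̄′∈L ω̄∈L)
        Q∈L = L.InSub-- λ′∈L λ̄′∈L
        P′∈L = L.InSub-* (L.InSub-- λ̄′∈L λ′∈L) (L.InSub-* ω∈L ω̄∈L)
        Q′∈L = L.InSub-- (L.InSub-* ω∈L λ̄′∈L) (L.InSub-* ω̄∈L λ′∈L)
        Q≢0 : Q ≢ 0#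
        Q≢0 Q≡0 = λ′≢λ̄′ (x∙y⁻¹≈ε⇒x≈y λ′ λ̄′ Q≡0)
        f̄y≡ : conj (f y) ≡ λ̄′ * (Φ x + x * ω̄)
        f̄y≡ = trans (cong conj fy≡λ′fx) (trans (K.^q^-* λ′ (f x)) (cong (λ̄′ *_) (conj-f x∈K)))
        δy≡ : δ * y ≡ P * x + Q * Φ x
        δy≡ = begin
          δ * y                                               ≡⟨ δ*z≡f-f̄ y∈K ⟩
          f y - conj (f y)                                    ≡⟨ cong₂ _-_ fy≡λ′fx f̄y≡ ⟩
          λ′ * (Φ x + x * ω) - λ̄′ * (Φ x + x * ω̄)
            ≡⟨ solve 6 (λ l l̄ v x ω ω̄ → l :* (v :+ x :* ω) :- l̄ :* (v :+ x :* ω̄)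
                := (l :* ω :- l̄ :* ω̄) :* x :+ (l :- l̄) :* v) refl λ′ λ̄′ (Φ x) x ω ω̄ ⟩
          P * x + Q * Φ x                                     ∎
        δΦy≡ : δ * Φ y ≡ P′ * x + Q′ * Φ x
        δΦy≡ = begin
          δ * Φ y                                             ≡⟨ δ*Φz≡ωf̄-ω̄f y∈K ⟩
          ω * conj (f y) - ω̄ * f y                            ≡⟨ cong₂ (λ u w → ω * u - ω̄ * w) f̄y≡ fy≡λ′fx ⟩
          ω * (λ̄′ * (Φ x + x * ω̄)) - ω̄ * (λ′ * (Φ x + x * ω))
            ≡⟨ solve 6 (λ l l̄ v x ω ω̄ → ω :* (l̄ :* (v :+ x :* ω̄)) :- ω̄ :* (l :* (v :+ x :* ω))
                := ((l̄ :- l) :* (ω :* ω̄)) :* x :+ (ω :* l̄ :- ω̄ :* l) :* v) refl λ′ λ̄′ (Φ x) x ω ω̄ ⟩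
          P′ * x + Q′ * Φ x                                   ∎

      scattered : Scattered n f
      scattered x x∈K fx≢0 y y∈K λ′ λ′∈L fy≡λ′fx with conj λ′ ≟ λ′
      ... | yes λ̄′≡λ′ = conj-fixed-scalar∈Fq x∈K (fx≢0⇒x≢0 fx≢0) y∈K λ′∈L λ̄′≡λ′ fy≡λ′fx
      ... | no  λ̄′≢λ′ = contradiction (conj-moved-scalar⇒Φ²x∈InSpan x∈K y∈K λ′∈L (λ̄′≢λ′ ∘ sym) fy≡λ′fx)
                                      (Φ²x∉InSpan (fx≢0⇒x≢0 fx≢0) x∈K)

open import Data.Nat using (_≤_; _∸_; _*_; _^_)

theorem2p3 : (q : ℕ) → IsPrimePower q → (n : ℕ) → 1 ≤ n → ¬ (3 ∣ n) →
    (F : FiniteField) → FiniteField.size F ≡ q ^ (6 * n) →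
    (ω : FiniteField.Carrier F) → FieldNotions.InSub F q (2 * n) ω → ¬ FieldNotions.InSub F q n ω →
    (a : FiniteField.Carrier F) → FieldNotions.InSub F q (3 * n) a → a ≢ FiniteField.0# F →
    (i : ℕ) → 1 ≤ i → i ≤ 3 * n ∸ 1 → gcd i (2 * n) ≡ 1 → gcd i (3 * n) ≡ 3 →
    ¬ FieldNotions.InSub F q 1 (FieldNotions.norm3 F q n a) →
    FieldNotions.HasRank3n F q n (FieldNotions.fmap F q a i ω) × FieldNotions.Scattered F q n (FieldNotions.fmap F q a i ω)
theorem2p3 q (p , k , p-prime , _ , q≡p^k) n _ 3∤n F size≡q^6n ω ω∈L ω∉Fqⁿ a a∈K a≢0 i _ _
           gcd[i,2n]≡1 gcd[i,3n]≡3 norm3∉Fq =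
  f-injective , scattered
  where
  open FiniteFieldTheory F
  p-additive : Additive p
  p-additive = frobenius-additive p-prime
    (size≡p^m⇒p·1≡0 {p} {k * (6 * n)} (trans size≡q^6n (trans (cong (_^ (6 * n)) q≡p^k) (ℕ.^-*-assoc p k (6 * n)))))
  q^-additive : ∀ m → Additive (q ^ m)
  q^-additive m = subst (λ r → Additive (r ^ m)) (sym q≡p^k) (Additive-^ {p ^ k} (Additive-^ {p} p-additive k) m)
  open Subfields q q^-additive
  open ScatteredLinearSet n 3∤n ω ω∈L ω∉Fqⁿ a a∈K a≢0 i gcd[i,2n]≡1 gcd[i,3n]≡3 norm3∉Fq
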